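{- Let $G=(V,E)$ be a precedence DAG of unit-time jobs with integer release dates, to be scheduled on $m$ identical machines. For an antichain $A$ of $G$ and integer $t\ge 1$, let $S(A,t)=1$ if there is a feasible schedule of makespan $t$ that processes all jobs of $\mathrm{pred}(A)$, and $S(A,t)=0$ otherwise. Then $$S(A,t) = \big(A \subseteq V(G^{t})\big) \wedge \bigvee_{X\subseteq A:\ |X| \le m} S(A',t-1), \quad\text{where } A' = \max(\mathrm{pred}(A)\setminus X).$$
   Context: Jobs have processing time $1$ and are placed in integer time slots $1,2,\dots$ on $m$ identical machines, at most one job per machine per slot; a job $j$ can be placed in slot $s$ only if $s\ge r_j$; if a processed job $b$ has $a\prec b$ then $a$ is processed in an earlier slot. The makespan is the largest slot used. The partial order $\preceq$ on $V$ is reachability in $G$. An antichain is a set of pairwise incomparable jobs. $\mathrm{pred}(A)=\{x: \exists a\in A,\ x\preceq a\}$. For a set $S\subseteq V$, $\max(S)$ denotes the set of maximal elements of the induced subgraph $G[S]$. $G^t$ is the subgraph of $G$ induced by the jobs with release date at most $t$. $S(A,0)=1$ iff $\mathrm{pred}(A)=\emptyset$. -}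

module Defs where

open import Level using (0ℓ)
open import Data.Nat using (ℕ; zero; suc; _≤_; _<_)
open import Data.Fin using (Fin)
open import Data.Fin.Subset using (Subset; _∈_; ∣_∣)
open import Data.Maybe using (Maybe; just)
open import Data.Product using (_×_; ∃; ∃-syntax; Σ-syntax)
open import Data.Empty using (⊥)
open import Relation.Nullary using (¬_)
open import Relation.Binary.PropositionalEquality using (_≡_; _≢_)
open import Data.Bool using (Bool; T)
open import Relation.Binary.Construct.Closure.ReflexiveTransitive using (Star)

JobSet : ℕ → Set₁
JobSet n = Fin n → Set

⟦_⟧ : {n : ℕ} → Subset n → JobSet n
⟦ A ⟧ x = x ∈ A

module _ {n : ℕ} (adj : Fin n → Fin n → Bool) where

  E : Fin n → Fin n → Set
  E x y = T (adj x y)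

  _⪯_ : Fin n → Fin n → Set
  a ⪯ b = Star E a b

  _≺_ : Fin n → Fin n → Set
  a ≺ b = (a ⪯ b) × (a ≢ b)

  IsDAG : Set
  IsDAG = ∀ {x y} → E x y → ¬ (y ⪯ x)

  IsAntichain : JobSet n → Set
  IsAntichain A = ∀ a b → A a → A b → a ⪯ b → a ≡ b

  pred : JobSet n → JobSet n
  pred A x = ∃[ a ] (A a × (x ⪯ a))

  maxOf : JobSet n → JobSet n
  maxOf S y = S y × (∀ z → E y z → ¬ S z)

  _∖_ : JobSet n → Subset n → JobSet n
  (S ∖ X) y = S y × ¬ (y ∈ X)

  -- A ⊆ V(G^t): all jobs of A have release date at most t
  ⊆Gt : (r : Fin n → ℕ) → JobSet n → ℕ → Set
  ⊆Gt r A t = ∀ a → A a → r a ≤ t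

  record FeasibleSchedule (r : Fin n → ℕ) (m : ℕ) (t : ℕ) (P : JobSet n) : Set where
    field
      σ : Fin n → Maybe (ℕ × Fin m)
      only : ∀ j p → σ j ≡ just p → P j
      covers : ∀ j → P j → ∃[ p ] (σ j ≡ just p)
      slot-ok : ∀ j s k → σ j ≡ just (s Data.Product., k) → (1 ≤ s) × (s ≤ t) × (r j ≤ s)
      capacity : ∀ i j p → σ i ≡ just p → σ j ≡ just p → i ≡ j
      precedence : ∀ a b sb kb → σ b ≡ just (sb Data.Product., kb) → a ≺ b →
                   ∃[ sa ] ∃[ ka ] ((σ a ≡ just (sa Data.Product., ka)) × (sa < sb))

  S : (r : Fin n → ℕ) (m : ℕ) → JobSet n → ℕ → Set
  S r m A zero    = ∀ x → ¬ pred A x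
  S r m A (suc t) = FeasibleSchedule r m (suc t) (pred A)

-- A schedule of makespan t + 1 for pred(A) splits into its last slot X and a schedule of makespan t
-- for the rest. X has at most m jobs, and a job in the last slot has no strict successor in pred(A),
-- so X ⊆ A; the rest is pred(A) ∖ X, which is down-closed because A is an antichain, and a
-- down-closed set is exactly pred of its maximal elements. Conversely, if X ⊆ A has at most m
-- jobs released by t + 1, placing X on distinct machines in slot t + 1 extends a schedule of
-- pred(A) ∖ X: every strict predecessor of X lies in pred(A) ∖ X and so is scheduled by time t.
-- Maximal elements exist above every element of a decidable set because the successor relation
-- of a finite DAG is well-founded, which also makes reachability decidable.
module Submission where

open import Defs
open import Data.Nat using (ℕ; suc; _≤_)
open import Data.Bool using (Bool)
open import Data.Fin using (Fin)
open import Data.Fin.Subset using (Subset; _∈_; ∣_∣)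
open import Data.Product using (_×_; ∃-syntax)
open import Function.Bundles using (_⇔_)

open import Level using (0ℓ)
open import Data.Nat using (zero; _<_; _+_; z≤n; s≤s; _≟_)
open import Data.Nat.Properties using (<⇒≱; +-monoʳ-≤; m≤m+n; ≤-trans; ≤-refl; n≤1+n; <⇒≢; <-≤-trans; ≤∧≢⇒<; <-irrefl; ≤-pred; +-suc)
open import Data.Bool using (true; false; if_then_else_)
open import Data.Fin using (zero; suc; punchOut) renaming (_≟_ to _≟ᶠ_)
open import Data.Fin.Properties using (any?; punchOut-injective; suc-injective)
open import Data.Fin.Subset using (_∉_; _⊂_; ⁅_⁆; _∪_) renaming (⊥ to ∅)
open import Data.Fin.Subset.Properties using (_∈?_; ∣p∣≤n; p⊂q⇒∣p∣<∣q∣; ∉⊥; x∈⁅x⁆; x∈⁅y⁆⇒x≡y; x∈p∪q⁺; x∈p∪q⁻; p⊆p∪q)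
open import Data.Vec using (_∷_; []; tabulate)
open import Data.Vec.Base using (here; there)
open import Data.Vec.Properties using ([]=⇒lookup; lookup⇒[]=; lookup∘tabulate)
open import Data.Maybe using (Maybe; just; nothing)
open import Data.Product using (Σ-syntax; _,_; proj₁; proj₂)
open import Data.Product.Properties using (,-injectiveʳ)
open import Data.Sum using (_⊎_; inj₁; inj₂)
open import Data.Empty using (⊥; ⊥-elim)
open import Function using (flip)
open import Function.Bundles using (mk⇔; Equivalence)
open import Induction.WellFounded using (Acc; acc; WellFounded)
open import Relation.Nullary using (¬_; Dec; yes; no; does; ¬?)
open import Relation.Nullary.Decidable using (T?; _×-dec_; map′; dec-true)
open import Relation.Binary.PropositionalEquality using (_≡_; _≢_; refl; sym; trans; cong; subst)
open import Relation.Binary.Construct.Closure.ReflexiveTransitive using (ε; _◅_; _◅◅_)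
open import Relation.Unary using (Pred; Decidable; _≐_) renaming (_⊆_ to _⊆ᵖ_)
open import Relation.Unary.Properties using (≐-sym)

module FiniteSubsets where

  Embedding : ∀ {n} → Subset n → ℕ → Set
  Embedding X m = Σ[ f ∈ (∀ j → j ∈ X → Fin m) ] (∀ {i j} p q → f i p ≡ f j q → i ≡ j)

  embedding⇒∣p∣≤ : ∀ {n m} (X : Subset n) → Embedding X m → ∣ X ∣ ≤ m
  embedding⇒∣p∣≤ [] _ = z≤n
  embedding⇒∣p∣≤ (false ∷ X) (f , inj) =
    embedding⇒∣p∣≤ X ((λ j p → f (suc j) (there p)) , λ p q e → suc-injective (inj (there p) (there q) e))
  embedding⇒∣p∣≤ {m = zero} (true ∷ X) (f , _) with f zero here
  ... | ()
  embedding⇒∣p∣≤ {m = suc m} (true ∷ X) (f , inj) = s≤s (embedding⇒∣p∣≤ X (f′ , inj′))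
    where
    f0≢ : ∀ {j} (p : j ∈ X) → f zero here ≢ f (suc j) (there p)
    f0≢ p e with inj here (there p) e
    ... | ()
    f′ : ∀ j → j ∈ X → Fin m
    f′ j p = punchOut (f0≢ p)
    inj′ : ∀ {i j} p q → f′ i p ≡ f′ j q → i ≡ j
    inj′ p q e = suc-injective (inj (there p) (there q) (punchOut-injective (f0≢ p) (f0≢ q) e))

  ∣p∣≤⇒embedding : ∀ {n m} (X : Subset n) → ∣ X ∣ ≤ m → Embedding X m
  ∣p∣≤⇒embedding [] _ = (λ _ ()) , λ ()
  ∣p∣≤⇒embedding (false ∷ X) ∣X∣≤m with ∣p∣≤⇒embedding X ∣X∣≤m
  ... | f , inj = g , g-inj
    where
    g : ∀ j → j ∈ false ∷ X → Fin _
    g (suc j) (there p) = f j p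
    g-inj : ∀ {i j} p q → g i p ≡ g j q → i ≡ j
    g-inj (there p) (there q) e = cong suc (inj p q e)
  ∣p∣≤⇒embedding {m = suc m} (true ∷ X) (s≤s ∣X∣≤m) with ∣p∣≤⇒embedding X ∣X∣≤m
  ... | f , inj = g , g-inj
    where
    g : ∀ j → j ∈ true ∷ X → Fin (suc m)
    g zero here = zero
    g (suc j) (there p) = suc (f j p)
    g-inj : ∀ {i j} p q → g i p ≡ g j q → i ≡ j
    g-inj here here e = refl
    g-inj here (there q) ()
    g-inj (there p) here ()
    g-inj (there p) (there q) e = cong suc (inj p q (suc-injective e))

  toSubset : ∀ {n} {P : Pred (Fin n) 0ℓ} → Decidable P → Subset n
  toSubset P? = tabulate (λ x → does (P? x))

  module _ {n} {P : Pred (Fin n) 0ℓ} (P? : Decidable P) where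

    ∈-toSubset⁺ : ∀ {x} → P x → x ∈ toSubset P?
    ∈-toSubset⁺ {x} Px = lookup⇒[]= x _ (trans (lookup∘tabulate _ x) (dec-true (P? x) Px))

    ∈-toSubset⁻ : ∀ {x} → x ∈ toSubset P? → P x
    ∈-toSubset⁻ {x} x∈ with P? x | trans (sym (lookup∘tabulate (λ y → does (P? y)) x)) ([]=⇒lookup x∈)
    ... | yes Px | _ = Px
    ... | no _   | ()

  x∉p⇒p⊂p∪⁅x⁆ : ∀ {n} {x : Fin n} {p : Subset n} → x ∉ p → p ⊂ p ∪ ⁅ x ⁆
  x∉p⇒p⊂p∪⁅x⁆ {x = x} x∉p = p⊆p∪q ⁅ x ⁆ , x , x∈p∪q⁺ (inj₂ (x∈⁅x⁆ x)) , x∉p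

  x∉p⇒∣p∣<n : ∀ {n} {x : Fin n} {p : Subset n} → x ∉ p → ∣ p ∣ < n
  x∉p⇒∣p∣<n {x = x} {p} x∉p = <-≤-trans (p⊂q⇒∣p∣<∣q∣ (x∉p⇒p⊂p∪⁅x⁆ x∉p)) (∣p∣≤n (p ∪ ⁅ x ⁆))

open FiniteSubsets

module Precedence {n : ℕ} (adj : Fin n → Fin n → Bool) where

  DownClosed : JobSet n → Set
  DownClosed S = ∀ {x y} → _⪯_ adj x y → S y → S x

  pred-maxOf⊆ : ∀ {S} → DownClosed S → pred adj (maxOf adj S) ⊆ᵖ S
  pred-maxOf⊆ closed (y , (Sy , _) , x⪯y) = closed x⪯y Sy

  pred-maximal⇒∈ : ∀ {A x} → pred adj A x → (∀ {y} → _≺_ adj x y → ¬ pred adj A y) → A x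
  pred-maximal⇒∈ {x = x} (a , Aa , x⪯a) maximal with x ≟ᶠ a
  ... | yes refl = Aa
  ... | no x≢a = ⊥-elim (maximal (x⪯a , x≢a) (a , Aa , ε))

  ≺-antichain⇒pred∖ : ∀ {A X a b} → IsAntichain adj A → (∀ {x} → x ∈ X → A x) →
                      b ∈ X → _≺_ adj a b → _∖_ adj (pred adj A) X a
  ≺-antichain⇒pred∖ anti X⊆A b∈X (a⪯b , a≢b) =
    (_ , X⊆A b∈X , a⪯b) , λ a∈X → a≢b (anti _ _ (X⊆A a∈X) (X⊆A b∈X) a⪯b)

  anySuccessor? : ∀ x {Q : JobSet n} → (∀ {z} → E adj x z → Dec (Q z)) → Dec (∃[ z ] (E adj x z × Q z))
  anySuccessor? x Q? = any? step
    where
    step : ∀ z → Dec (E adj x z × _)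
    step z with T? (adj x z)
    ... | yes e = map′ (e ,_) proj₂ (Q? e)
    ... | no ¬e = no (λ p → ¬e (proj₁ p))

  module Acyclic (dag : IsDAG adj) where

    ⪯-antisym : ∀ {x y} → _⪯_ adj x y → _⪯_ adj y x → x ≡ y
    ⪯-antisym ε _ = refl
    ⪯-antisym (e ◅ p) q = ⊥-elim (dag e (p ◅◅ q))

    -- Each step along an edge adds the current vertex to V, where acyclicity keeps it fresh;
    -- since ∣ V ∣ < n, the fuel k bounds the number of remaining steps.
    acc-visited : ∀ k {x} (V : Subset n) → x ∉ V → (∀ {v} → v ∈ V → _⪯_ adj v x) → n ≤ k + ∣ V ∣ →
                  Acc (flip (E adj)) x
    acc-visited zero V x∉V _ n≤∣V∣ = ⊥-elim (<⇒≱ (x∉p⇒∣p∣<n x∉V) n≤∣V∣)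
    acc-visited (suc k) {x} V x∉V V⪯x n≤ = acc λ e →
      acc-visited k (V ∪ ⁅ x ⁆) (z∉ e) (V′⪯z e)
        (≤-trans n≤ (subst (_≤ k + ∣ V ∪ ⁅ x ⁆ ∣) (+-suc k ∣ V ∣) k+∣V∣<k+∣V′∣))
      where
      k+∣V∣<k+∣V′∣ : k + suc ∣ V ∣ ≤ k + ∣ V ∪ ⁅ x ⁆ ∣
      k+∣V∣<k+∣V′∣ = +-monoʳ-≤ k (p⊂q⇒∣p∣<∣q∣ (x∉p⇒p⊂p∪⁅x⁆ x∉V))
      z∉ : ∀ {z} → E adj x z → z ∉ V ∪ ⁅ x ⁆
      z∉ e z∈ with x∈p∪q⁻ V ⁅ x ⁆ z∈
      ... | inj₁ z∈V = dag e (V⪯x z∈V)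
      ... | inj₂ z∈⁅x⁆ rewrite x∈⁅y⁆⇒x≡y _ z∈⁅x⁆ = dag e ε
      V′⪯z : ∀ {z} → E adj x z → ∀ {v} → v ∈ V ∪ ⁅ x ⁆ → _⪯_ adj v z
      V′⪯z e v∈ with x∈p∪q⁻ V ⁅ x ⁆ v∈
      ... | inj₁ v∈V = V⪯x v∈V ◅◅ (e ◅ ε)
      ... | inj₂ v∈⁅x⁆ rewrite x∈⁅y⁆⇒x≡y _ v∈⁅x⁆ = e ◅ ε

    successor-wellFounded : WellFounded (flip (E adj))
    successor-wellFounded x = acc-visited n ∅ ∉⊥
      (λ v∈⊥ → ⊥-elim (∉⊥ v∈⊥))
      (m≤m+n n ∣ ∅ {n} ∣)

    _⪯?_ : ∀ x y → Dec (_⪯_ adj x y)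
    x ⪯? y = go (successor-wellFounded x)
      where
      go : ∀ {x} → Acc (flip (E adj)) x → Dec (_⪯_ adj x y)
      go {x} (acc rs) with x ≟ᶠ y
      ... | yes refl = yes ε
      ... | no x≢y = map′ (λ (_ , e , p) → e ◅ p) (λ { ε → ⊥-elim (x≢y refl) ; (e ◅ p) → _ , e , p })
                          (anySuccessor? x (λ e → go (rs e)))

    pred? : ∀ {A} → Decidable A → Decidable (pred adj A)
    pred? A? x = any? (λ a → A? a ×-dec (x ⪯? a))

    maxOf-above : ∀ {S} → Decidable S → ∀ {x} → S x → ∃[ y ] (maxOf adj S y × _⪯_ adj x y)
    maxOf-above {S} S? {x} = go (successor-wellFounded x)
      where
      go : ∀ {x} → Acc (flip (E adj)) x → S x → ∃[ y ] (maxOf adj S y × _⪯_ adj x y)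
      go {x} (acc rs) Sx with anySuccessor? x (λ {z} _ → S? z)
      ... | yes (z , e , Sz) = let (y , max-y , z⪯y) = go (rs e) Sz in y , max-y , e ◅ z⪯y
      ... | no ¬succ = x , (Sx , λ z e Sz → ¬succ (z , e , Sz)) , ε

    pred-maxOf≐ : ∀ {S} → Decidable S → DownClosed S → pred adj (maxOf adj S) ≐ S
    pred-maxOf≐ S? closed = pred-maxOf⊆ closed , maxOf-above S?

    pred∖antichain-downClosed : ∀ {A X} → IsAntichain adj A → (∀ {x} → x ∈ X → A x) →
                                DownClosed (_∖_ adj (pred adj A) X)
    pred∖antichain-downClosed {X = X} anti X⊆A {x} x⪯y ((b , Ab , y⪯b) , y∉X) = (b , Ab , x⪯y ◅◅ y⪯b) , x∉X
      where
      x∉X : x ∉ X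
      x∉X x∈X with anti _ b (X⊆A x∈X) Ab (x⪯y ◅◅ y⪯b)
      ... | refl = y∉X (subst (_∈ _) (⪯-antisym x⪯y y⪯b) x∈X)

module Schedules {n : ℕ} (adj : Fin n → Fin n → Bool) (r : Fin n → ℕ) (m : ℕ) where

  open FeasibleSchedule

  released : ∀ {t P j} → FeasibleSchedule adj r m t P → P j → r j ≤ t
  released F Pj with covers F _ Pj
  ... | (s , k) , e with slot-ok F _ s k e
  ... | _ , s≤t , rj≤s = ≤-trans rj≤s s≤t

  reindex : ∀ {t P Q} → P ≐ Q → FeasibleSchedule adj r m t P → FeasibleSchedule adj r m t Q
  σ (reindex _ F) = σ F
  only (reindex (P⊆Q , _) F) j p e = P⊆Q (only F j p e)
  covers (reindex (_ , Q⊆P) F) j Qj = covers F j (Q⊆P Qj)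
  slot-ok (reindex _ F) = slot-ok F
  capacity (reindex _ F) = capacity F
  precedence (reindex _ F) = precedence F

  emptySchedule : ∀ {t P} → (∀ x → ¬ P x) → FeasibleSchedule adj r m t P
  σ (emptySchedule _) _ = nothing
  only (emptySchedule _) _ _ ()
  covers (emptySchedule none) j Pj = ⊥-elim (none j Pj)
  slot-ok (emptySchedule _) _ _ _ ()
  capacity (emptySchedule _) _ _ _ ()
  precedence (emptySchedule _) _ _ _ _ ()

  makespan-zero⇒empty : ∀ {P} → FeasibleSchedule adj r m 0 P → ∀ x → ¬ P x
  makespan-zero⇒empty F x Px with covers F x Px
  ... | (s , k) , e with slot-ok F x s k e
  ... | 1≤s , s≤0 , _ with ≤-trans 1≤s s≤0
  ... | ()

  S⇔schedule : ∀ B t → S adj r m B t ⇔ FeasibleSchedule adj r m t (pred adj B)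
  S⇔schedule B zero = mk⇔ emptySchedule makespan-zero⇒empty
  S⇔schedule B (suc t) = mk⇔ (λ F → F) (λ F → F)

  InSlot : ℕ → Maybe (ℕ × Fin m) → Set
  InSlot s o = ∃[ k ] (o ≡ just (s , k))

  inSlot? : ∀ s o → Dec (InSlot s o)
  inSlot? s nothing = no λ ()
  inSlot? s (just (s′ , k)) with s′ ≟ s
  ... | yes refl = yes (k , refl)
  ... | no s′≢s = no λ { (_ , refl) → s′≢s refl }

  inSlot-just : ∀ {s s′ k} → InSlot s (just (s′ , k)) → s′ ≡ s
  inSlot-just (_ , refl) = refl

  dropSlot : ℕ → Maybe (ℕ × Fin m) → Maybe (ℕ × Fin m)
  dropSlot s o = if does (inSlot? s o) then nothing else o

  dropSlot-just : ∀ {s o p} → dropSlot s o ≡ just p → (o ≡ just p) × ¬ InSlot s o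
  dropSlot-just {s} {o} e with inSlot? s o
  dropSlot-just () | yes _
  ... | no ¬in = e , ¬in

  dropSlot-keep : ∀ {s o} → ¬ InSlot s o → dropSlot s o ≡ o
  dropSlot-keep {s} {o} ¬in with inSlot? s o
  ... | yes in-s = ⊥-elim (¬in in-s)
  ... | no _ = refl

  module _ {t : ℕ} {P : JobSet n} (F : FeasibleSchedule adj r m (suc t) P) where

    lastSlot : Subset n
    lastSlot = toSubset (λ j → inSlot? (suc t) (σ F j))

    ∈lastSlot⁺ : ∀ {j} → InSlot (suc t) (σ F j) → j ∈ lastSlot
    ∈lastSlot⁺ = ∈-toSubset⁺ (λ j → inSlot? (suc t) (σ F j))

    ∈lastSlot⁻ : ∀ {j} → j ∈ lastSlot → InSlot (suc t) (σ F j)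
    ∈lastSlot⁻ = ∈-toSubset⁻ (λ j → inSlot? (suc t) (σ F j))

    lastSlot-⊆ : ∀ {j} → j ∈ lastSlot → P j
    lastSlot-⊆ j∈ = let (k , e) = ∈lastSlot⁻ j∈ in only F _ _ e

    lastSlot-maximal : ∀ {i j} → j ∈ lastSlot → _≺_ adj j i → ¬ P i
    lastSlot-maximal j∈ j≺i Pi with covers F _ Pi
    ... | (si , ki) , ei with precedence F _ _ si ki ei j≺i
    ... | sj , _ , ej , sj<si with ∈lastSlot⁻ j∈
    ... | _ , ej′ = <⇒≢ (<-≤-trans sj<si (proj₁ (proj₂ (slot-ok F _ si ki ei))))
                        (inSlot-just (subst (InSlot (suc t)) ej (_ , ej′)))

    ∣lastSlot∣≤m : ∣ lastSlot ∣ ≤ m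
    ∣lastSlot∣≤m = embedding⇒∣p∣≤ lastSlot ((λ j j∈ → proj₁ (∈lastSlot⁻ j∈)) , machine-injective)
      where
      machine-injective : ∀ {i j} p q → proj₁ (∈lastSlot⁻ p) ≡ proj₁ (∈lastSlot⁻ q) → i ≡ j
      machine-injective p q e with ∈lastSlot⁻ p | ∈lastSlot⁻ q
      ... | k , ei | _ , ej rewrite e = capacity F _ _ (suc t , _) ei ej

    dropLastSlot : FeasibleSchedule adj r m t (_∖_ adj P lastSlot)
    σ dropLastSlot j = dropSlot (suc t) (σ F j)
    only dropLastSlot j p e = let (e′ , ¬last) = dropSlot-just e in
      only F j p e′ , λ j∈ → ¬last (∈lastSlot⁻ j∈)
    covers dropLastSlot j (Pj , j∉) = let (p , e) = covers F j Pj in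
      p , trans (dropSlot-keep (λ last → j∉ (∈lastSlot⁺ last))) e
    slot-ok dropLastSlot j s k e with dropSlot-just e
    ... | e′ , ¬last with slot-ok F j s k e′
    ... | 1≤s , s≤1+t , rj≤s = 1≤s , ≤-pred (≤∧≢⇒< s≤1+t (λ { refl → ¬last (k , e′) })) , rj≤s
    capacity dropLastSlot i j p ei ej = capacity F i j p (proj₁ (dropSlot-just ei)) (proj₁ (dropSlot-just ej))
    precedence dropLastSlot a b sb kb e a≺b with dropSlot-just e
    ... | eb , _ with precedence F a b sb kb eb a≺b
    ... | sa , ka , ea , sa<sb = sa , ka , trans (dropSlot-keep ¬last) ea , sa<sb
      where
      ¬last : ¬ InSlot (suc t) (σ F a)
      ¬last last = <⇒≢ (<-≤-trans sa<sb (proj₁ (proj₂ (slot-ok F b sb kb eb))))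
                       (inSlot-just (subst (InSlot (suc t)) ea last))

  addLastSlot : ∀ {t P X} → (∀ {x} → x ∈ X → P x) → ∣ X ∣ ≤ m → (∀ {x} → x ∈ X → r x ≤ suc t) →
                (∀ {a b} → b ∈ X → _≺_ adj a b → _∖_ adj P X a) →
                FeasibleSchedule adj r m t (_∖_ adj P X) → FeasibleSchedule adj r m (suc t) P
  addLastSlot {t} {P} {X} X⊆P ∣X∣≤m X-released X-preds F = G
    where
    machine : ∀ j → j ∈ X → Fin m
    machine = proj₁ (∣p∣≤⇒embedding X ∣X∣≤m)

    machine-injective : ∀ {i j} p q → machine i p ≡ machine j q → i ≡ j
    machine-injective = proj₂ (∣p∣≤⇒embedding X ∣X∣≤m)

    extend : ∀ j → Dec (j ∈ X) → Maybe (ℕ × Fin m)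
    extend j (yes j∈X) = just (suc t , machine j j∈X)
    extend j (no _) = σ F j

    extend-just : ∀ {j d p} → extend j d ≡ just p →
                  (Σ[ j∈X ∈ j ∈ X ] p ≡ (suc t , machine j j∈X)) ⊎ (j ∉ X × σ F j ≡ just p)
    extend-just {d = yes j∈X} refl = inj₁ (j∈X , refl)
    extend-just {d = no j∉X} e = inj₂ (j∉X , e)

    extend-∉ : ∀ {j} d → j ∉ X → extend j d ≡ σ F j
    extend-∉ (yes j∈X) j∉X = ⊥-elim (j∉X j∈X)
    extend-∉ (no _) _ = refl

    extend-covers : ∀ {j} d → (j ∉ X → ∃[ p ] (σ F j ≡ just p)) → ∃[ p ] (extend j d ≡ just p)
    extend-covers (yes _) _ = _ , refl
    extend-covers (no j∉X) covered = covered j∉X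

    not-in-last : ∀ {j k} → σ F j ≡ just (suc t , k) → ⊥
    not-in-last e = <-irrefl refl (proj₁ (proj₂ (slot-ok F _ _ _ e)))

    G : FeasibleSchedule adj r m (suc t) P
    σ G j = extend j (j ∈? X)
    only G j p e with extend-just {d = j ∈? X} e
    ... | inj₁ (j∈X , _) = X⊆P j∈X
    ... | inj₂ (_ , e′) = proj₁ (only F j p e′)
    covers G j Pj = extend-covers (j ∈? X) (λ j∉X → covers F j (Pj , j∉X))
    slot-ok G j s k e with extend-just {d = j ∈? X} e
    ... | inj₁ (j∈X , refl) = s≤s z≤n , ≤-refl , X-released j∈X
    ... | inj₂ (_ , e′) = let (1≤s , s≤t , rj≤s) = slot-ok F j s k e′ in 1≤s , ≤-trans s≤t (n≤1+n t) , rj≤s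
    capacity G i j p ei ej with extend-just {d = i ∈? X} ei | extend-just {d = j ∈? X} ej
    ... | inj₁ (i∈X , refl) | inj₁ (j∈X , e) = machine-injective i∈X j∈X (,-injectiveʳ e)
    ... | inj₂ (_ , e₁) | inj₂ (_ , e₂) = capacity F i j p e₁ e₂
    ... | inj₁ (_ , refl) | inj₂ (_ , e₂) = ⊥-elim (not-in-last e₂)
    ... | inj₂ (_ , e₁) | inj₁ (_ , refl) = ⊥-elim (not-in-last e₁)
    precedence G a b sb kb e a≺b with extend-just {d = b ∈? X} e
    ... | inj₁ (b∈X , refl) =
      let (a∈P∖X@(_ , a∉X)) = X-preds b∈X a≺b
          ((sa , ka) , ea) = covers F a a∈P∖X
      in sa , ka , trans (extend-∉ (a ∈? X) a∉X) ea , s≤s (proj₁ (proj₂ (slot-ok F a sa ka ea)))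
    ... | inj₂ (_ , eb) =
      let (sa , ka , ea , sa<sb) = precedence F a b sb kb eb a≺b
      in sa , ka , trans (extend-∉ (a ∈? X) (proj₂ (only F a _ ea))) ea , sa<sb

lemma4 : (n m : ℕ) (adj : Fin n → Fin n → Bool) (r : Fin n → ℕ) → IsDAG adj →
    (A : Subset n) → IsAntichain adj ⟦ A ⟧ → (t : ℕ) →
    S adj r m ⟦ A ⟧ (suc t) ⇔
    (⊆Gt adj r ⟦ A ⟧ (suc t) ×
    ∃[ X ] ((∀ x → x ∈ X → x ∈ A) × (∣ X ∣ ≤ m) ×
    S adj r m (maxOf adj (_∖_ adj (pred adj ⟦ A ⟧) X)) t))
lemma4 n m adj r dag A anti t = mk⇔
  (λ F → A-released F , lastSlot F , lastSlot⊆A F , ∣lastSlot∣≤m F ,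
         Equivalence.from (S⇔schedule _ t) (reindex (≐-sym (rest≐ (lastSlot⊆A F))) (dropLastSlot F)))
  (λ (A≤1+t , X , X⊆A , ∣X∣≤m , rest) →
         addLastSlot (λ x∈X → _ , X⊆A _ x∈X , ε) ∣X∣≤m (λ x∈X → A≤1+t _ (X⊆A _ x∈X))
           (≺-antichain⇒pred∖ anti (X⊆A _)) (reindex (rest≐ X⊆A) (Equivalence.to (S⇔schedule _ t) rest)))
  where
  open Precedence adj
  open Acyclic dag
  open Schedules adj r m

  A-released : FeasibleSchedule adj r m (suc t) (pred adj ⟦ A ⟧) → ⊆Gt adj r ⟦ A ⟧ (suc t)
  A-released F a a∈A = released F (a , a∈A , ε)

  lastSlot⊆A : (F : FeasibleSchedule adj r m (suc t) (pred adj ⟦ A ⟧)) → ∀ x → x ∈ lastSlot F → x ∈ A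
  lastSlot⊆A F x x∈ = pred-maximal⇒∈ (lastSlot-⊆ F x∈) (lastSlot-maximal F x∈)

  rest≐ : ∀ {X} → (∀ x → x ∈ X → x ∈ A) →
          pred adj (maxOf adj (_∖_ adj (pred adj ⟦ A ⟧) X)) ≐ _∖_ adj (pred adj ⟦ A ⟧) X
  rest≐ {X} X⊆A = pred-maxOf≐ (λ x → pred? (_∈? A) x ×-dec ¬? (x ∈? X)) (pred∖antichain-downClosed anti (X⊆A _))
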